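{- Let $n,r,k$ be natural numbers with $n\ge r\ge 2$ and $k>r$. If $L\subseteq\{0,1,\ldots,\binom{k}{r}\}$ is a $3$-good list, then $$d(r-1,n)\le 2^k n.$$
   Context: An $r$-graph is an $r$-uniform hypergraph. An $r$-graph $G$ is $(L,k)$-free if for every $i\in L$ there is no set of $k$ vertices of $G$ spanning exactly $i$ edges. $L$ is $3$-good if $\{i,i+1,i+2\}\cap L\neq\emptyset$ for all $i\in\{0,\ldots,\binom{k}{r}-2\}$. Let $\mathcal{F}(n)$ be the family of $(L,k)$-free $r$-graphs on $[n]=\{1,\ldots,n\}$. For $A\subseteq[n]$ and $H\in\mathcal{F}(n)$, let $D(A,H,n)=\{G\in\mathcal{F}(n): A\subseteq e \text{ for all } e\in E(G)\,\triangle\, E(H)\}$, where $\triangle$ is symmetric difference. For $a\le n$, let $d(a,n)=\max\{|D(A,H,n)|: H\in\mathcal{F}(n)\}$, where $A$ is any $a$-element subset of $[n]$ (independent of the choice of $A$). -}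

module Defs where

open import Data.Nat using (ℕ; zero; suc; _+_; _*_; _∸_; _^_; _≤_; _<_)
open import Data.Nat.Combinatorics using (_C_)
open import Data.Bool using (Bool; true; false; _∧_)
open import Data.Vec using (Vec; []; _∷_)
open import Data.List using (List; []; _∷_; _++_; map; length)
open import Data.List.Relation.Unary.All using (All)
open import Data.List.Relation.Unary.AllPairs using (AllPairs)
open import Data.Fin.Subset using (Subset; _⊆_; ∣_∣; inside; outside)
open import Data.Fin.Subset.Properties using (_⊆?_)
open import Data.Product using (_×_)
open import Data.Sum using (_⊎_)
open import Relation.Nullary using (¬_)
open import Relation.Nullary.Decidable using (isYes)
open import Relation.Binary.PropositionalEquality using (_≡_; _≢_)

allSubsets : (n : ℕ) → List (Subset n)
allSubsets zero = [] ∷ []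
allSubsets (suc n) = map (inside ∷_) (allSubsets n) ++ map (outside ∷_) (allSubsets n)

-- A hypergraph on vertex set [n] = Fin n: the characteristic function of its edge set.
Graph : ℕ → Set
Graph n = Subset n → Bool

IsRGraph : {n : ℕ} → ℕ → Graph n → Set
IsRGraph r G = ∀ e → G e ≡ true → ∣ e ∣ ≡ r

countTrue : {n : ℕ} → (Subset n → Bool) → List (Subset n) → ℕ
countTrue p [] = 0
countTrue p (x ∷ xs) with p x
... | true = suc (countTrue p xs)
... | false = countTrue p xs

edgesIn : {n : ℕ} → Graph n → Subset n → ℕ
edgesIn {n} G S = countTrue (λ e → G e ∧ isYes (e ⊆? S)) (allSubsets n)

LkFree : {n : ℕ} → (L : ℕ → Set) → ℕ → Graph n → Set
LkFree L k G = ∀ S → ∣ S ∣ ≡ k → ∀ i → L i → edgesIn G S ≢ i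

InF : (n r k : ℕ) → (L : ℕ → Set) → Graph n → Set
InF n r k L G = IsRGraph r G × LkFree L k G

ListBounded : (k r : ℕ) → (ℕ → Set) → Set
ListBounded k r L = ∀ i → L i → i ≤ k C r

ThreeGood : (k r : ℕ) → (ℕ → Set) → Set
ThreeGood k r L = ∀ i → i + 2 ≤ k C r → L i ⊎ L (suc i) ⊎ L (suc (suc i))

InD : (n r k : ℕ) → (L : ℕ → Set) → Subset n → Graph n → Graph n → Set
InD n r k L A H G = InF n r k L G × (∀ e → G e ≢ H e → A ⊆ e)

Distinct : {n : ℕ} → Graph n → Graph n → Set
Distinct G G′ = ¬ (∀ e → G e ≡ G′ e)

-- |D(A,H,n)| ≤ m : every list of pairwise distinct members of D(A,H,n) has length ≤ m.
DCardLe : (n r k : ℕ) → (L : ℕ → Set) → Subset n → Graph n → ℕ → Set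
DCardLe n r k L A H m =
  (Gs : List (Graph n)) → AllPairs Distinct Gs → All (InD n r k L A H) Gs → length Gs ≤ m

{-# OPTIONS --safe #-}
module Submission where

-- Every edge on which a member G of D(A,H,n) differs from H contains A, so it is A ∪ {v} for
-- some v, and G is determined by its link {v : A ∪ {v} ∈ E(G)}, a 0/1 vector of length n.
-- Choose B ⊇ A with |B| = k − 2 (or B = [n]).  No three links can agree on B and climb through
-- the values 00, 01, 11 on two coordinates i, j ∉ B: on the k-set B ∪ {i, j} the three graphs
-- would span c, c + 1 and c + 2 edges, and 3-goodness puts one of these numbers in L.  A
-- Sauer–Shelah-type induction bounds any family of vectors without such a staircase by
-- 2^|B| (n + 1), which is at most 2^k n.

open import Defs
open import Data.Bool using (Bool; true; false; _∧_; _∨_; not; _≟_)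
open import Data.Bool.Properties using (∧-zeroʳ; ∧-identityʳ; T-≡)
open import Data.Empty using (⊥)
open import Data.Fin using (Fin; zero; suc)
open import Data.Fin.Subset using (Subset; inside; outside; _∈_; _∉_; _⊆_; _∪_; ⁅_⁆; ∣_∣; ⊤)
open import Data.Fin.Subset.Properties
  using (_⊆?_; drop-∷-⊆; s⊆s; out⊆; ⊆-refl; p⊆q⇒∣p∣≤∣q∣; ∪-identityʳ; x∈⁅x⁆; x∈⁅y⁆⇒x≡y; x∈p∪q⁻; p⊆p∪q; q⊆p∪q; ∈⊤)
open import Data.List using (List; []; _∷_; _++_; map; length)
open import Data.List.Properties using (length-map)
open import Data.List.Membership.Propositional using () renaming (_∈_ to _∈ₗ_)
open import Data.List.Membership.Propositional.Properties using (∈-map⁻)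
open import Data.List.Relation.Unary.All as All using (All; []; _∷_)
open import Data.List.Relation.Unary.AllPairs using (AllPairs; []; _∷_)
open import Data.List.Relation.Unary.AllPairs.Properties using (map⁺)
open import Data.List.Relation.Unary.Any using (any?)
open import Data.Nat using (ℕ; zero; suc; _+_; _*_; _∸_; _^_; _≤_; _<_; z≤n; s≤s; _≡ᵇ_)
open import Data.Nat.Combinatorics using (_C_; nCk+nC[k+1]≡[n+1]C[k+1])
open import Data.Nat.Properties
  using ( ≤-refl; ≤-reflexive; ≤-trans; m≤n⇒m≤1+n; n≤1+n; m≤m+n; <⇒≱; suc-injective; ≡⇒≡ᵇ; m∸n+n≡m
        ; +-comm; +-suc; +-identityʳ; *-comm; *-assoc; *-suc
        ; +-mono-≤; +-monoʳ-≤; +-monoʳ-<; *-monoˡ-≤; *-monoʳ-≤; ^-monoʳ-≤; module ≤-Reasoning )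
open import Data.Product as Product using (Σ; ∃; _×_; _,_; proj₁; proj₂)
open import Data.Sum as Sum using (_⊎_; inj₁; inj₂)
open import Data.Vec using ([]; _∷_; tail; lookup; tabulate; here; there)
open import Data.Vec.Properties using (≡-dec; ∷-injectiveʳ; lookup∘tabulate; tabulate∘lookup; tabulate-cong)
open import Function using (_∘_; id)
open import Function.Bundles using (Equivalence)
open import Relation.Binary.Definitions using (DecidableEquality)
open import Relation.Binary.PropositionalEquality
  using (_≡_; _≢_; refl; sym; trans; cong; cong₂; subst; module ≡-Reasoning)
open import Relation.Nullary using (¬_; contradiction)
open import Relation.Nullary.Decidable
  using (does; isYes; yes; no; dec-true; dec-false; ⌊⌋-map′; isYes≗does; decidable-stable)

private
  variable
    n : ℕ

-- Counting subsets of [n]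

countTrue-++ : (p : Subset n → Bool) (xs ys : List (Subset n)) →
               countTrue p (xs ++ ys) ≡ countTrue p xs + countTrue p ys
countTrue-++ p []       ys = refl
countTrue-++ p (x ∷ xs) ys with p x
... | true  = cong suc (countTrue-++ p xs ys)
... | false = countTrue-++ p xs ys

countTrue-map : ∀ {m} (p : Subset n → Bool) (f : Subset m → Subset n) (xs : List (Subset m)) →
                countTrue p (map f xs) ≡ countTrue (p ∘ f) xs
countTrue-map p f []       = refl
countTrue-map p f (x ∷ xs) with p (f x)
... | true  = cong suc (countTrue-map p f xs)
... | false = countTrue-map p f xs

countTrue-cong : {p q : Subset n → Bool} → (∀ x → p x ≡ q x) → ∀ xs → countTrue p xs ≡ countTrue q xs
countTrue-cong                 p≗q []       = refl
countTrue-cong {p = p} {q = q} p≗q (x ∷ xs) with p x | q x | p≗q x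
... | true  | true  | _ = cong suc (countTrue-cong p≗q xs)
... | false | false | _ = countTrue-cong p≗q xs

countTrue-mono : {p q : Subset n → Bool} → (∀ x → p x ≡ true → q x ≡ true) →
                 ∀ xs → countTrue p xs ≤ countTrue q xs
countTrue-mono                 p⇒q []       = z≤n
countTrue-mono {p = p} {q = q} p⇒q (x ∷ xs) with p x in px | q x in qx
... | true  | true  = s≤s (countTrue-mono p⇒q xs)
... | false | true  = m≤n⇒m≤1+n (countTrue-mono p⇒q xs)
... | false | false = countTrue-mono p⇒q xs
... | true  | false with () ← trans (sym (p⇒q x px)) qx

countTrue≤length : (p : Subset n → Bool) (xs : List (Subset n)) → countTrue p xs ≤ length xs
countTrue≤length p []       = z≤n
countTrue≤length p (x ∷ xs) with p x
... | true  = s≤s (countTrue≤length p xs)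
... | false = m≤n⇒m≤1+n (countTrue≤length p xs)

countTrue-none : {p : Subset n → Bool} → (∀ x → p x ≡ false) → ∀ xs → countTrue p xs ≡ 0
countTrue-none         ¬p []       = refl
countTrue-none {p = p} ¬p (x ∷ xs) with p x | ¬p x
... | false | _ = countTrue-none ¬p xs

countTrue-∨-∧ : (p q : Subset n → Bool) (xs : List (Subset n)) →
                countTrue p xs + countTrue q xs ≡
                countTrue (λ x → p x ∨ q x) xs + countTrue (λ x → p x ∧ q x) xs
countTrue-∨-∧ p q []       = refl
countTrue-∨-∧ p q (x ∷ xs) with p x | q x
... | true  | true  = cong suc (trans (+-suc _ _) (trans (cong suc (countTrue-∨-∧ p q xs)) (sym (+-suc _ _))))
... | true  | false = cong suc (countTrue-∨-∧ p q xs)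
... | false | true  = trans (+-suc _ _) (cong suc (countTrue-∨-∧ p q xs))
... | false | false = countTrue-∨-∧ p q xs

countTrue-allSubsets-suc : (p : Subset (suc n) → Bool) →
  countTrue p (allSubsets (suc n)) ≡
  countTrue (p ∘ (inside ∷_)) (allSubsets n) + countTrue (p ∘ (outside ∷_)) (allSubsets n)
countTrue-allSubsets-suc {n} p = begin
  countTrue p (map (inside ∷_) (allSubsets n) ++ map (outside ∷_) (allSubsets n))
    ≡⟨ countTrue-++ p (map (inside ∷_) (allSubsets n)) (map (outside ∷_) (allSubsets n)) ⟩
  countTrue p (map (inside ∷_) (allSubsets n)) + countTrue p (map (outside ∷_) (allSubsets n))
    ≡⟨ cong₂ _+_ (countTrue-map p (inside ∷_) (allSubsets n)) (countTrue-map p (outside ∷_) (allSubsets n)) ⟩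
  countTrue (p ∘ (inside ∷_)) (allSubsets n) + countTrue (p ∘ (outside ∷_)) (allSubsets n) ∎
  where open ≡-Reasoning

countTrue-allSubsets-one-more : (p q : Subset n → Bool) (e₀ : Subset n) →
  (∀ e → e ≢ e₀ → p e ≡ q e) → p e₀ ≡ false → q e₀ ≡ true →
  countTrue q (allSubsets n) ≡ suc (countTrue p (allSubsets n))
countTrue-allSubsets-one-more {zero} p q [] _ pe₀ qe₀ rewrite pe₀ | qe₀ = refl
countTrue-allSubsets-one-more {suc n} p q (b ∷ e₀) p≗q pe₀ qe₀
  rewrite countTrue-allSubsets-suc p | countTrue-allSubsets-suc q with b
... | inside  = cong₂ _+_
        (countTrue-allSubsets-one-more _ _ e₀ (λ e e≢e₀ → p≗q _ (e≢e₀ ∘ cong tail)) pe₀ qe₀)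
        (countTrue-cong (λ e → sym (p≗q _ λ ())) (allSubsets n))
... | outside = trans
        (cong₂ _+_ (countTrue-cong (λ e → sym (p≗q _ λ ())) (allSubsets n))
          (countTrue-allSubsets-one-more _ _ e₀ (λ e e≢e₀ → p≗q _ (e≢e₀ ∘ cong tail)) pe₀ qe₀))
        (+-suc _ _)

_≟ₛ_ : DecidableEquality (Subset n)
_≟ₛ_ = ≡-dec _≟_

distinct≤countTrue : (p : Subset n → Bool) (us : List (Subset n)) →
  AllPairs _≢_ us → All (λ u → p u ≡ true) us → length us ≤ countTrue p (allSubsets n)
distinct≤countTrue p []       []             []          = z≤n
distinct≤countTrue p (u ∷ us) (u≢us ∷ uniq) (pu ∷ pus) = begin
  suc (length us)                   ≤⟨ s≤s (distinct≤countTrue p′ us uniq (All.zipWith p′-holds (u≢us , pus))) ⟩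
  suc (countTrue p′ (allSubsets _)) ≡⟨ sym (countTrue-allSubsets-one-more p′ p u p′≗p p′u pu) ⟩
  countTrue p (allSubsets _)          ∎
  where
  open ≤-Reasoning
  p′ : Subset _ → Bool
  p′ e = p e ∧ not (does (e ≟ₛ u))
  p′≗p : ∀ e → e ≢ u → p′ e ≡ p e
  p′≗p e e≢u rewrite dec-false (e ≟ₛ u) e≢u = ∧-identityʳ (p e)
  p′u : p′ u ≡ false
  p′u rewrite dec-true (u ≟ₛ u) refl = ∧-zeroʳ (p u)
  p′-holds : ∀ {e} → (u ≢ e) × p e ≡ true → p′ e ≡ true
  p′-holds (u≢e , pe) = trans (p′≗p _ (u≢e ∘ sym)) pe

-- A Sauer–Shelah-type bound

Agree : Subset n → Subset n → Subset n → Set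
Agree B u v = ∀ {x} → x ∈ B → lookup u x ≡ lookup v x

∷-agree : ∀ {B u v b h} → Agree {n} B u v → Agree (b ∷ B) (h ∷ u) (h ∷ v)
∷-agree u~v here          = refl
∷-agree u~v (there x∈B) = u~v x∈B

∷-agree-outside : ∀ {B u v h h′} → Agree {n} B u v → Agree (outside ∷ B) (h ∷ u) (h′ ∷ v)
∷-agree-outside u~v (there x∈B) = u~v x∈B

TraceInjective : (Subset n → Bool) → Subset n → Set
TraceInjective P B = ∀ {u v} → P u ≡ true → P v ≡ true → Agree B u v → u ≡ v

anyHead bothHeads : (Subset (suc n) → Bool) → Subset n → Bool
anyHead   P w = P (inside ∷ w) ∨ P (outside ∷ w)
bothHeads P w = P (inside ∷ w) ∧ P (outside ∷ w)

countTrue-anyHead-bothHeads : (P : Subset (suc n) → Bool) →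
  countTrue P (allSubsets (suc n)) ≡
  countTrue (anyHead P) (allSubsets n) + countTrue (bothHeads P) (allSubsets n)
countTrue-anyHead-bothHeads {n} P =
  trans (countTrue-allSubsets-suc P) (countTrue-∨-∧ (P ∘ (inside ∷_)) (P ∘ (outside ∷_)) (allSubsets n))

anyHead-witness : (P : Subset (suc n) → Bool) {w : Subset n} →
                  anyHead P w ≡ true → Σ Bool λ b → P (b ∷ w) ≡ true
anyHead-witness P {w} Pw with P (inside ∷ w) in P1w
... | true  = inside , P1w
... | false = outside , Pw

countTrue≤2^∣B∣ : (P : Subset n → Bool) (B : Subset n) → TraceInjective P B →
                   countTrue P (allSubsets n) ≤ 2 ^ ∣ B ∣
countTrue≤2^∣B∣ {zero}  P []           _     = countTrue≤length P (allSubsets 0)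
countTrue≤2^∣B∣ {suc n} P (inside ∷ B) inj = begin
  countTrue P (allSubsets (suc n))
    ≡⟨ countTrue-allSubsets-suc P ⟩
  countTrue (P ∘ (inside ∷_)) (allSubsets n) + countTrue (P ∘ (outside ∷_)) (allSubsets n)
    ≤⟨ +-mono-≤ (countTrue≤2^∣B∣ _ B (tail-inj inside)) (countTrue≤2^∣B∣ _ B (tail-inj outside)) ⟩
  2 ^ ∣ B ∣ + 2 ^ ∣ B ∣
    ≡⟨ cong (2 ^ ∣ B ∣ +_) (sym (+-identityʳ _)) ⟩
  2 ^ suc ∣ B ∣ ∎
  where
  open ≤-Reasoning
  tail-inj : ∀ b → TraceInjective (P ∘ (b ∷_)) B
  tail-inj b Pu Pv u~v = ∷-injectiveʳ (inj Pu Pv (∷-agree u~v))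
countTrue≤2^∣B∣ {suc n} P (outside ∷ B) inj = begin
  countTrue P (allSubsets (suc n))
    ≡⟨ countTrue-anyHead-bothHeads P ⟩
  countTrue (anyHead P) (allSubsets n) + countTrue (bothHeads P) (allSubsets n)
    ≡⟨ cong (countTrue (anyHead P) (allSubsets n) +_) (countTrue-none both-false (allSubsets n)) ⟩
  countTrue (anyHead P) (allSubsets n) + 0
    ≡⟨ +-identityʳ _ ⟩
  countTrue (anyHead P) (allSubsets n)
    ≤⟨ countTrue≤2^∣B∣ (anyHead P) B anyHead-inj ⟩
  2 ^ ∣ B ∣ ∎
  where
  open ≤-Reasoning
  both-false : ∀ w → bothHeads P w ≡ false
  both-false w with P (inside ∷ w) in P1w | P (outside ∷ w) in P0w
  ... | true  | true  with () ← inj P1w P0w (∷-agree-outside (λ _ → refl))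
  ... | true  | false = refl
  ... | false | _     = refl
  anyHead-inj : TraceInjective (anyHead P) B
  anyHead-inj Pu Pv u~v with anyHead-witness P Pu | anyHead-witness P Pv
  ... | _ , Pbu | _ , Pbv = ∷-injectiveʳ (inj Pbu Pbv (∷-agree-outside u~v))

bothHeads-inside : (P : Subset (suc n) → Bool) {w : Subset n} → bothHeads P w ≡ true → P (inside ∷ w) ≡ true
bothHeads-inside P {w} Pw with P (inside ∷ w) | Pw
... | true | _ = refl

bothHeads-outside : (P : Subset (suc n) → Bool) {w : Subset n} → bothHeads P w ≡ true → P (outside ∷ w) ≡ true
bothHeads-outside P {w} Pw with P (inside ∷ w) | Pw
... | true | P0w = P0w

lookup-extensionality : {u v : Subset n} → (∀ x → lookup u x ≡ lookup v x) → u ≡ v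
lookup-extensionality {u = u} {v} u≗v =
  trans (sym (tabulate∘lookup u)) (trans (tabulate-cong u≗v) (tabulate∘lookup v))

record Staircase (B : Subset n) (i j : Fin n) (u₀ u₁ u₂ : Subset n) : Set where
  field
    agree₀₁ : Agree B u₀ u₁
    agree₁₂ : Agree B u₁ u₂
    u₀[i]   : lookup u₀ i ≡ false
    u₀[j]   : lookup u₀ j ≡ false
    u₁[i]   : lookup u₁ i ≡ false
    u₁[j]   : lookup u₁ j ≡ true
    u₂[i]   : lookup u₂ i ≡ true
    u₂[j]   : lookup u₂ j ≡ true

StaircaseFree : (Subset n → Bool) → Subset n → Set
StaircaseFree P B = ∀ {i j u₀ u₁ u₂} → P u₀ ≡ true → P u₁ ≡ true → P u₂ ≡ true → ¬ Staircase B i j u₀ u₁ u₂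

∷-staircase : ∀ {B B′ i j u₀ u₁ u₂ h₀ h₁ h₂} →
  Agree B′ (h₀ ∷ u₀) (h₁ ∷ u₁) → Agree B′ (h₁ ∷ u₁) (h₂ ∷ u₂) →
  Staircase {n} B i j u₀ u₁ u₂ → Staircase B′ (suc i) (suc j) (h₀ ∷ u₀) (h₁ ∷ u₁) (h₂ ∷ u₂)
∷-staircase ~₀₁ ~₁₂ s = record
  { agree₀₁ = ~₀₁ ; agree₁₂ = ~₁₂
  ; u₀[i] = u₀[i] ; u₀[j] = u₀[j] ; u₁[i] = u₁[i] ; u₁[j] = u₁[j] ; u₂[i] = u₂[i] ; u₂[j] = u₂[j] }
  where open Staircase s

staircase-coordinates : ∀ {B i j u₀ u₁ u₂} → Staircase {n} B i j u₀ u₁ u₂ → i ∉ B × j ∉ B × i ≢ j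
staircase-coordinates {B = B} {i} {j} s = i∉B , j∉B , i≢j
  where
  open Staircase s
  i∉B : i ∉ B
  i∉B i∈B with () ← trans (sym u₁[i]) (trans (agree₁₂ i∈B) u₂[i])
  j∉B : j ∉ B
  j∉B j∈B with () ← trans (sym u₀[j]) (trans (agree₀₁ j∈B) u₁[j])
  i≢j : i ≢ j
  i≢j refl with () ← trans (sym u₁[i]) u₁[j]

-- Two vectors of bothHeads P that agree on B but differ at x give the staircase 0u, 0v, 1v
-- on the coordinates 0 and x.
bothHeads-traceInjective : (P : Subset (suc n) → Bool) (B : Subset n) →
  StaircaseFree P (outside ∷ B) → TraceInjective (bothHeads P) B
bothHeads-traceInjective P B free {u} {v} Pu Pv u~v = lookup-extensionality same
  where
  climb : ∀ {u v x} → bothHeads P u ≡ true → bothHeads P v ≡ true → Agree B u v →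
          lookup u x ≡ false → lookup v x ≡ true → ⊥
  climb {u} {v} {x} Pu Pv u~v ux vx =
    free {zero} {suc x} (bothHeads-outside P Pu) (bothHeads-outside P Pv) (bothHeads-inside P Pv) record
      { agree₀₁ = ∷-agree-outside u~v ; agree₁₂ = ∷-agree-outside (λ _ → refl)
      ; u₀[i] = refl ; u₀[j] = ux ; u₁[i] = refl ; u₁[j] = vx ; u₂[i] = refl ; u₂[j] = vx }
  same : ∀ x → lookup u x ≡ lookup v x
  same x with lookup u x in ux | lookup v x in vx
  ... | true  | true  = refl
  ... | false | false = refl
  ... | false | true  with () ← climb Pu Pv u~v ux vx
  ... | true  | false with () ← climb Pv Pu (sym ∘ u~v) vx ux

countTrue≤2^∣B∣*[1+n] : (P : Subset n → Bool) (B : Subset n) → StaircaseFree P B →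
                         countTrue P (allSubsets n) ≤ 2 ^ ∣ B ∣ * suc n
countTrue≤2^∣B∣*[1+n] {zero}  P []           _    = countTrue≤length P (allSubsets 0)
countTrue≤2^∣B∣*[1+n] {suc n} P (inside ∷ B) free = begin
  countTrue P (allSubsets (suc n))
    ≡⟨ countTrue-allSubsets-suc P ⟩
  countTrue (P ∘ (inside ∷_)) (allSubsets n) + countTrue (P ∘ (outside ∷_)) (allSubsets n)
    ≤⟨ +-mono-≤ (countTrue≤2^∣B∣*[1+n] _ B (tail-free inside)) (countTrue≤2^∣B∣*[1+n] _ B (tail-free outside)) ⟩
  2 ^ ∣ B ∣ * suc n + 2 ^ ∣ B ∣ * suc n
    ≡⟨ cong (2 ^ ∣ B ∣ * suc n +_) (+-identityʳ _) ⟨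
  2 * (2 ^ ∣ B ∣ * suc n)
    ≡⟨ *-assoc 2 (2 ^ ∣ B ∣) (suc n) ⟨
  2 ^ suc ∣ B ∣ * suc n
    ≤⟨ *-monoʳ-≤ (2 ^ suc ∣ B ∣) (n≤1+n (suc n)) ⟩
  2 ^ suc ∣ B ∣ * suc (suc n) ∎
  where
  open ≤-Reasoning
  tail-free : ∀ b → StaircaseFree (P ∘ (b ∷_)) B
  tail-free b P₀ P₁ P₂ s = free P₀ P₁ P₂ (∷-staircase (∷-agree agree₀₁) (∷-agree agree₁₂) s)
    where open Staircase s
countTrue≤2^∣B∣*[1+n] {suc n} P (outside ∷ B) free = begin
  countTrue P (allSubsets (suc n))
    ≡⟨ countTrue-anyHead-bothHeads P ⟩
  countTrue (anyHead P) (allSubsets n) + countTrue (bothHeads P) (allSubsets n)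
    ≤⟨ +-mono-≤ (countTrue≤2^∣B∣*[1+n] (anyHead P) B anyHead-free)
                (countTrue≤2^∣B∣ (bothHeads P) B (bothHeads-traceInjective P B free)) ⟩
  2 ^ ∣ B ∣ * suc n + 2 ^ ∣ B ∣
    ≡⟨ +-comm (2 ^ ∣ B ∣ * suc n) (2 ^ ∣ B ∣) ⟩
  2 ^ ∣ B ∣ + 2 ^ ∣ B ∣ * suc n
    ≡⟨ *-suc (2 ^ ∣ B ∣) (suc n) ⟨
  2 ^ ∣ B ∣ * suc (suc n) ∎
  where
  open ≤-Reasoning
  anyHead-free : StaircaseFree (anyHead P) B
  anyHead-free P₀ P₁ P₂ s with anyHead-witness P P₀ | anyHead-witness P P₁ | anyHead-witness P P₂
  ... | _ , P₀′ | _ , P₁′ | _ , P₂′ =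
    free P₀′ P₁′ P₂′ (∷-staircase (∷-agree-outside agree₀₁) (∷-agree-outside agree₁₂) s)
    where open Staircase s

-- Subsets of [n]

enlarge : ℕ → Subset n → Subset n
enlarge zero    p             = p
enlarge (suc c) []            = []
enlarge (suc c) (inside  ∷ p) = inside ∷ enlarge (suc c) p
enlarge (suc c) (outside ∷ p) = inside ∷ enlarge c p

p⊆enlarge : ∀ c (p : Subset n) → p ⊆ enlarge c p
p⊆enlarge zero    p             = ⊆-refl
p⊆enlarge (suc c) []            = ⊆-refl
p⊆enlarge (suc c) (inside  ∷ p) = s⊆s (p⊆enlarge (suc c) p)
p⊆enlarge (suc c) (outside ∷ p) = out⊆ (p⊆enlarge c p)

∣enlarge∣≤ : ∀ c (p : Subset n) → ∣ enlarge c p ∣ ≤ c + ∣ p ∣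
∣enlarge∣≤ zero    p             = ≤-refl
∣enlarge∣≤ (suc c) []            = z≤n
∣enlarge∣≤ (suc c) (inside  ∷ p) = s≤s (≤-trans (∣enlarge∣≤ (suc c) p) (≤-reflexive (sym (+-suc c ∣ p ∣))))
∣enlarge∣≤ (suc c) (outside ∷ p) = s≤s (∣enlarge∣≤ c p)

enlarge≡⊤⊎∣enlarge∣≡ : ∀ c (p : Subset n) → enlarge c p ≡ ⊤ ⊎ ∣ enlarge c p ∣ ≡ c + ∣ p ∣
enlarge≡⊤⊎∣enlarge∣≡ zero    p             = inj₂ refl
enlarge≡⊤⊎∣enlarge∣≡ (suc c) []            = inj₁ refl
enlarge≡⊤⊎∣enlarge∣≡ (suc c) (inside  ∷ p) =
  Sum.map (cong (inside ∷_)) (λ eq → cong suc (trans eq (sym (+-suc c ∣ p ∣)))) (enlarge≡⊤⊎∣enlarge∣≡ (suc c) p)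
enlarge≡⊤⊎∣enlarge∣≡ (suc c) (outside ∷ p) =
  Sum.map (cong (inside ∷_)) (cong suc) (enlarge≡⊤⊎∣enlarge∣≡ c p)

p⊆q∧∣q∣≡∣p∣⇒q≡p : {p q : Subset n} → p ⊆ q → ∣ q ∣ ≡ ∣ p ∣ → q ≡ p
p⊆q∧∣q∣≡∣p∣⇒q≡p {p = []}          {[]}          _   _   = refl
p⊆q∧∣q∣≡∣p∣⇒q≡p {p = inside  ∷ p} {inside  ∷ q} p⊆q eq =
  cong (inside ∷_) (p⊆q∧∣q∣≡∣p∣⇒q≡p (drop-∷-⊆ p⊆q) (suc-injective eq))
p⊆q∧∣q∣≡∣p∣⇒q≡p {p = outside ∷ p} {outside ∷ q} p⊆q eq =
  cong (outside ∷_) (p⊆q∧∣q∣≡∣p∣⇒q≡p (drop-∷-⊆ p⊆q) eq)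
p⊆q∧∣q∣≡∣p∣⇒q≡p {p = inside  ∷ p} {outside ∷ q} p⊆q eq with () ← p⊆q here
p⊆q∧∣q∣≡∣p∣⇒q≡p {p = outside ∷ p} {inside  ∷ q} p⊆q eq =
  contradiction (p⊆q⇒∣p∣≤∣q∣ (drop-∷-⊆ p⊆q)) (<⇒≱ (≤-reflexive eq))

p⊆q∧∣q∣≡1+∣p∣⇒q≡p∪⁅x⁆ : {p q : Subset n} → p ⊆ q → ∣ q ∣ ≡ suc ∣ p ∣ → ∃ λ x → q ≡ p ∪ ⁅ x ⁆
p⊆q∧∣q∣≡1+∣p∣⇒q≡p∪⁅x⁆ {p = inside  ∷ p} {inside  ∷ q} p⊆q eq =
  Product.map suc (cong (inside ∷_)) (p⊆q∧∣q∣≡1+∣p∣⇒q≡p∪⁅x⁆ (drop-∷-⊆ p⊆q) (suc-injective eq))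
p⊆q∧∣q∣≡1+∣p∣⇒q≡p∪⁅x⁆ {p = outside ∷ p} {outside ∷ q} p⊆q eq =
  Product.map suc (cong (outside ∷_)) (p⊆q∧∣q∣≡1+∣p∣⇒q≡p∪⁅x⁆ (drop-∷-⊆ p⊆q) eq)
p⊆q∧∣q∣≡1+∣p∣⇒q≡p∪⁅x⁆ {p = inside  ∷ p} {outside ∷ q} p⊆q eq with () ← p⊆q here
p⊆q∧∣q∣≡1+∣p∣⇒q≡p∪⁅x⁆ {p = outside ∷ p} {inside  ∷ q} p⊆q eq =
  zero , cong (inside ∷_) (trans (p⊆q∧∣q∣≡∣p∣⇒q≡p (drop-∷-⊆ p⊆q) (suc-injective eq)) (sym (∪-identityʳ p)))

x∈p∪⁅x⁆ : (p : Subset n) (x : Fin n) → x ∈ p ∪ ⁅ x ⁆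
x∈p∪⁅x⁆ p x = q⊆p∪q p ⁅ x ⁆ (x∈⁅x⁆ x)

x∈p∪⁅y⁆⁻ : (p : Subset n) (y : Fin n) {x : Fin n} → x ∈ p ∪ ⁅ y ⁆ → x ∈ p ⊎ x ≡ y
x∈p∪⁅y⁆⁻ p y x∈ = Sum.map₂ (x∈⁅y⁆⇒x≡y y) (x∈p∪q⁻ p ⁅ y ⁆ x∈)

p∪⁅x⁆⊆q : {p q : Subset n} {x : Fin n} → p ⊆ q → x ∈ q → p ∪ ⁅ x ⁆ ⊆ q
p∪⁅x⁆⊆q {p = p} {x = x} p⊆q x∈q y∈ with x∈p∪⁅y⁆⁻ p x y∈
... | inj₁ y∈p  = p⊆q y∈p
... | inj₂ refl = x∈q

∣p∪⁅x⁆∣≡1+∣p∣ : (p : Subset n) (x : Fin n) → x ∉ p → ∣ p ∪ ⁅ x ⁆ ∣ ≡ suc ∣ p ∣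
∣p∪⁅x⁆∣≡1+∣p∣ (inside  ∷ p) zero    x∉p = contradiction here x∉p
∣p∪⁅x⁆∣≡1+∣p∣ (outside ∷ p) zero    x∉p = cong (suc ∘ ∣_∣) (∪-identityʳ p)
∣p∪⁅x⁆∣≡1+∣p∣ (inside  ∷ p) (suc x) x∉p = cong suc (∣p∪⁅x⁆∣≡1+∣p∣ p x (x∉p ∘ there))
∣p∪⁅x⁆∣≡1+∣p∣ (outside ∷ p) (suc x) x∉p = ∣p∪⁅x⁆∣≡1+∣p∣ p x (x∉p ∘ there)

x∈p∪⁅y⁆∪⁅z⁆⁻ : (p : Subset n) (y z : Fin n) {x : Fin n} → x ∈ (p ∪ ⁅ y ⁆) ∪ ⁅ z ⁆ → x ∈ p ⊎ x ≡ y ⊎ x ≡ z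
x∈p∪⁅y⁆∪⁅z⁆⁻ p y z x∈ = Sum.assocʳ (Sum.map₁ (x∈p∪⁅y⁆⁻ p y) (x∈p∪⁅y⁆⁻ (p ∪ ⁅ y ⁆) z x∈))

∣p∪⁅x⁆∪⁅y⁆∣≡2+∣p∣ : (p : Subset n) (x y : Fin n) → x ∉ p → y ∉ p → x ≢ y → ∣ (p ∪ ⁅ x ⁆) ∪ ⁅ y ⁆ ∣ ≡ 2 + ∣ p ∣
∣p∪⁅x⁆∪⁅y⁆∣≡2+∣p∣ p x y x∉p y∉p x≢y =
  trans (∣p∪⁅x⁆∣≡1+∣p∣ (p ∪ ⁅ x ⁆) y y∉p∪⁅x⁆) (cong suc (∣p∪⁅x⁆∣≡1+∣p∣ p x x∉p))
  where
  y∉p∪⁅x⁆ : y ∉ p ∪ ⁅ x ⁆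
  y∉p∪⁅x⁆ y∈ with x∈p∪⁅y⁆⁻ p x y∈
  ... | inj₁ y∈p = y∉p y∈p
  ... | inj₂ y≡x = x≢y (sym y≡x)

countTrue-subsetsOfSize : (r : ℕ) (S : Subset n) →
  countTrue (λ e → (∣ e ∣ ≡ᵇ r) ∧ isYes (e ⊆? S)) (allSubsets n) ≡ ∣ S ∣ C r
countTrue-subsetsOfSize {zero}  zero    [] = refl
countTrue-subsetsOfSize {zero}  (suc r) [] = refl
countTrue-subsetsOfSize {suc n} r (s ∷ S) =
  trans (countTrue-allSubsets-suc (λ e → (∣ e ∣ ≡ᵇ r) ∧ isYes (e ⊆? (s ∷ S))))
        (trans (cong₂ _+_ refl outsideHeads) (insideHeads s r))
  where
  outsideHeads : countTrue (λ e → (∣ e ∣ ≡ᵇ r) ∧ isYes ((outside ∷ e) ⊆? (s ∷ S))) (allSubsets n) ≡ ∣ S ∣ C r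
  outsideHeads = trans (countTrue-cong (λ e → cong ((∣ e ∣ ≡ᵇ r) ∧_) (⌊⌋-map′ _ _ (e ⊆? S))) (allSubsets n))
                       (countTrue-subsetsOfSize r S)
  insideHeads : ∀ s r → countTrue (λ e → (suc ∣ e ∣ ≡ᵇ r) ∧ isYes ((inside ∷ e) ⊆? (s ∷ S))) (allSubsets n) + ∣ S ∣ C r ≡ ∣ s ∷ S ∣ C r
  insideHeads outside r       = cong (_+ ∣ S ∣ C r) (countTrue-none (λ e → ∧-zeroʳ _) (allSubsets n))
  insideHeads inside  zero    = cong (_+ ∣ S ∣ C 0) (countTrue-none (λ e → refl) (allSubsets n))
  insideHeads inside  (suc r) = trans (cong (_+ ∣ S ∣ C suc r)
      (trans (countTrue-cong (λ e → cong ((∣ e ∣ ≡ᵇ r) ∧_) (⌊⌋-map′ _ _ (e ⊆? S))) (allSubsets n))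
             (countTrue-subsetsOfSize r S)))
    (nCk+nC[k+1]≡[n+1]C[k+1] ∣ S ∣ r)

-- Members of D(A,H,n) and their links

edgesIn≤C : {r : ℕ} {G : Graph n} → IsRGraph r G → (S : Subset n) → edgesIn G S ≤ ∣ S ∣ C r
edgesIn≤C {n} {r} {G} G-uniform S =
  ≤-trans (countTrue-mono edge⇒r-subset (allSubsets n)) (≤-reflexive (countTrue-subsetsOfSize r S))
  where
  edge⇒r-subset : ∀ e → (G e ∧ isYes (e ⊆? S)) ≡ true → ((∣ e ∣ ≡ᵇ r) ∧ isYes (e ⊆? S)) ≡ true
  edge⇒r-subset e Ge∧e⊆S with G e in Ge
  ... | true = trans (cong (_∧ isYes (e ⊆? S)) (Equivalence.to T-≡ (≡⇒≡ᵇ ∣ e ∣ r (G-uniform e Ge)))) Ge∧e⊆S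

differ⇒∣e∣≡r : {r : ℕ} {G G′ : Graph n} → IsRGraph r G → IsRGraph r G′ → ∀ {e} → G e ≢ G′ e → ∣ e ∣ ≡ r
differ⇒∣e∣≡r {G = G} {G′} G-uniform G′-uniform {e} Ge≢G′e with G e in Ge | G′ e in G′e
... | true  | _     = G-uniform e Ge
... | false | true  = G′-uniform e G′e
... | false | false = contradiction refl Ge≢G′e

link : Subset n → Graph n → Subset n
link A G = tabulate (λ v → G (A ∪ ⁅ v ⁆))

lookup-link : (A : Subset n) (G : Graph n) (v : Fin n) → lookup (link A G) v ≡ G (A ∪ ⁅ v ⁆)
lookup-link A G = lookup∘tabulate (λ v → G (A ∪ ⁅ v ⁆))

linkFamily : Subset n → List (Graph n) → Subset n → Bool
linkFamily A Gs u = does (any? (u ≟ₛ_) (map (link A) Gs))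

linkFamily-member : (A : Subset n) (Gs : List (Graph n)) {u : Subset n} →
  linkFamily A Gs u ≡ true → ∃ λ G → G ∈ₗ Gs × link A G ≡ u
linkFamily-member A Gs {u} u∈ with any? (u ≟ₛ_) (map (link A) Gs) | u∈
... | yes u∈links | _ with G , G∈Gs , u≡ ← ∈-map⁻ (link A) u∈links = G , G∈Gs , sym u≡

module _ {n r k : ℕ} {L : ℕ → Set} {A : Subset n} {H : Graph n} (r≡1+∣A∣ : r ≡ suc ∣ A ∣) where
  private
    D : Graph n → Set
    D = InD n r k L A H

    uniform : ∀ {G} → D G → IsRGraph r G
    uniform = proj₁ ∘ proj₁

    L-free : ∀ {G} → D G → LkFree L k G
    L-free = proj₂ ∘ proj₁

  differ⇒⊇A : ∀ {G G′ e} → D G → D G′ → G e ≢ G′ e → A ⊆ e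
  differ⇒⊇A {G} {G′} {e} (_ , near-G) (_ , near-G′) Ge≢G′e with G e ≟ H e
  ... | no  Ge≢He = near-G e Ge≢He
  ... | yes Ge≡He = near-G′ e (λ G′e≡He → Ge≢G′e (trans Ge≡He (sym G′e≡He)))

  differ⇒extension : ∀ {G G′ e} → D G → D G′ → G e ≢ G′ e → ∃ λ v → e ≡ A ∪ ⁅ v ⁆
  differ⇒extension DG DG′ Ge≢G′e = p⊆q∧∣q∣≡1+∣p∣⇒q≡p∪⁅x⁆ (differ⇒⊇A DG DG′ Ge≢G′e)
    (trans (differ⇒∣e∣≡r (uniform DG) (uniform DG′) Ge≢G′e) r≡1+∣A∣)

  agree-by-links : ∀ {G G′ e} → D G → D G′ →
    (∀ v → e ≡ A ∪ ⁅ v ⁆ → lookup (link A G) v ≡ lookup (link A G′) v) → G e ≡ G′ e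
  agree-by-links {G} {G′} {e} DG DG′ links-agree = decidable-stable (G e ≟ G′ e) λ Ge≢G′e →
    let v , e≡ = differ⇒extension DG DG′ Ge≢G′e in
    Ge≢G′e (subst (λ e → G e ≡ G′ e) (sym e≡)
      (trans (sym (lookup-link A G v)) (trans (links-agree v e≡) (lookup-link A G′ v))))

  link-injective : ∀ {G G′} → D G → D G′ → link A G ≡ link A G′ → ∀ e → G e ≡ G′ e
  link-injective DG DG′ links≡ e = agree-by-links DG DG′ (λ v _ → cong (λ u → lookup u v) links≡)

  edgesIn-step : ∀ {G G′ S w} → D G → D G′ → A ∪ ⁅ w ⁆ ⊆ S →
    lookup (link A G) w ≡ false → lookup (link A G′) w ≡ true →
    (∀ {v} → v ∈ S → v ≢ w → lookup (link A G) v ≡ lookup (link A G′) v) →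
    edgesIn G′ S ≡ suc (edgesIn G S)
  edgesIn-step {G} {G′} {S} {w} DG DG′ A∪w⊆S Gw G′w links-agree =
    countTrue-allSubsets-one-more _ _ (A ∪ ⁅ w ⁆) same
      (cong (_∧ _) (trans (sym (lookup-link A G w)) Gw))
      (cong₂ _∧_ (trans (sym (lookup-link A G′ w)) G′w) (trans (isYes≗does ((A ∪ ⁅ w ⁆) ⊆? S)) (dec-true ((A ∪ ⁅ w ⁆) ⊆? S) A∪w⊆S)))
    where
    same : ∀ e → e ≢ A ∪ ⁅ w ⁆ → (G e ∧ isYes (e ⊆? S)) ≡ (G′ e ∧ isYes (e ⊆? S))
    same e e≢ with e ⊆? S
    ... | no  _   = trans (∧-zeroʳ (G e)) (sym (∧-zeroʳ (G′ e)))
    ... | yes e⊆S = cong (_∧ true) (agree-by-links DG DG′ λ v e≡ →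
          links-agree (e⊆S (subst (v ∈_) (sym e≡) (x∈p∪⁅x⁆ A v))) λ { refl → e≢ e≡ })

  module _ (3-good : ThreeGood k r L) {B : Subset n} (A⊆B : A ⊆ B) (B-size : B ≡ ⊤ ⊎ 2 + ∣ B ∣ ≡ k) where

    no-staircase-of-links : ∀ {G₀ G₁ G₂ i j} → D G₀ → D G₁ → D G₂ →
                            ¬ Staircase B i j (link A G₀) (link A G₁) (link A G₂)
    no-staircase-of-links {G₀} {G₁} {G₂} {i} {j} DG₀ DG₁ DG₂ s with staircase-coordinates s
    ... | i∉B , j∉B , i≢j = forbidden (3-good (edgesIn G₀ S) count-bound)
      where
      open Staircase s
      S : Subset n
      S = (B ∪ ⁅ i ⁆) ∪ ⁅ j ⁆

      ∣S∣≡k : ∣ S ∣ ≡ k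
      ∣S∣≡k = trans (∣p∪⁅x⁆∪⁅y⁆∣≡2+∣p∣ B i j i∉B j∉B i≢j)
                    (Sum.[ (λ B≡⊤ → contradiction (subst (i ∈_) (sym B≡⊤) ∈⊤) i∉B) , id ] B-size)

      A⊆S : A ⊆ S
      A⊆S = p⊆p∪q ⁅ j ⁆ ∘ p⊆p∪q ⁅ i ⁆ ∘ A⊆B

      step₀₁ : edgesIn G₁ S ≡ suc (edgesIn G₀ S)
      step₀₁ = edgesIn-step DG₀ DG₁ (p∪⁅x⁆⊆q A⊆S (x∈p∪⁅x⁆ _ j)) u₀[j] u₁[j] links-agree
        where
        links-agree : ∀ {v} → v ∈ S → v ≢ j → lookup (link A G₀) v ≡ lookup (link A G₁) v
        links-agree v∈S v≢j with x∈p∪⁅y⁆∪⁅z⁆⁻ B i j v∈S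
        ... | inj₁ v∈B         = agree₀₁ v∈B
        ... | inj₂ (inj₁ refl) = trans u₀[i] (sym u₁[i])
        ... | inj₂ (inj₂ refl) = contradiction refl v≢j

      step₁₂ : edgesIn G₂ S ≡ suc (edgesIn G₁ S)
      step₁₂ = edgesIn-step DG₁ DG₂ (p∪⁅x⁆⊆q A⊆S (p⊆p∪q ⁅ j ⁆ (x∈p∪⁅x⁆ B i))) u₁[i] u₂[i] links-agree
        where
        links-agree : ∀ {v} → v ∈ S → v ≢ i → lookup (link A G₁) v ≡ lookup (link A G₂) v
        links-agree v∈S v≢i with x∈p∪⁅y⁆∪⁅z⁆⁻ B i j v∈S
        ... | inj₁ v∈B         = agree₁₂ v∈B
        ... | inj₂ (inj₁ refl) = contradiction refl v≢i
        ... | inj₂ (inj₂ refl) = trans u₁[j] (sym u₂[j])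

      count-bound : edgesIn G₀ S + 2 ≤ k C r
      count-bound = begin
        edgesIn G₀ S + 2        ≡⟨ +-comm (edgesIn G₀ S) 2 ⟩
        suc (suc (edgesIn G₀ S)) ≡⟨ trans step₁₂ (cong suc step₀₁) ⟨
        edgesIn G₂ S            ≤⟨ edgesIn≤C (uniform DG₂) S ⟩
        ∣ S ∣ C r               ≡⟨ cong (_C r) ∣S∣≡k ⟩
        k C r                   ∎
        where open ≤-Reasoning

      c : ℕ
      c = edgesIn G₀ S
      forbidden : L c ⊎ L (suc c) ⊎ L (suc (suc c)) → ⊥
      forbidden (inj₁ L[c])        = L-free DG₀ S ∣S∣≡k c L[c] refl
      forbidden (inj₂ (inj₁ L[c])) = L-free DG₁ S ∣S∣≡k (suc c) L[c] step₀₁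
      forbidden (inj₂ (inj₂ L[c])) = L-free DG₂ S ∣S∣≡k (suc (suc c)) L[c] (trans step₁₂ (cong suc step₀₁))

    linkFamily-staircaseFree : ∀ {Gs} → All D Gs → StaircaseFree (linkFamily A Gs) B
    linkFamily-staircaseFree {Gs} Ds P₀ P₁ P₂
      with linkFamily-member A Gs P₀ | linkFamily-member A Gs P₁ | linkFamily-member A Gs P₂
    ... | _ , G₀∈ , refl | _ , G₁∈ , refl | _ , G₂∈ , refl =
      no-staircase-of-links (All.lookup Ds G₀∈) (All.lookup Ds G₁∈) (All.lookup Ds G₂∈)

    links-distinct : ∀ {Gs} → All D Gs → AllPairs Distinct Gs → AllPairs _≢_ (map (link A) Gs)
    links-distinct Ds distinct = map⁺ (go Ds distinct)
      where
      go : ∀ {Gs} → All D Gs → AllPairs Distinct Gs → AllPairs (λ G G′ → link A G ≢ link A G′) Gs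
      go []         []                = []
      go (DG ∷ Ds) (G≉Gs ∷ distinct) =
        All.zipWith (λ (DG′ , G≉G′) links≡ → G≉G′ (link-injective DG DG′ links≡)) (Ds , G≉Gs) ∷ go Ds distinct

    ∣D∣≤2^∣B∣*[1+n] : (Gs : List (Graph n)) → AllPairs Distinct Gs → All D Gs → length Gs ≤ 2 ^ ∣ B ∣ * suc n
    ∣D∣≤2^∣B∣*[1+n] Gs distinct Ds = begin
      length Gs                                   ≡⟨ length-map (link A) Gs ⟨
      length (map (link A) Gs)                    ≤⟨ distinct≤countTrue (linkFamily A Gs) _ (links-distinct Ds distinct)
                                                       (All.tabulate (dec-true (any? _ _))) ⟩
      countTrue (linkFamily A Gs) (allSubsets n)  ≤⟨ countTrue≤2^∣B∣*[1+n] _ B (linkFamily-staircaseFree Ds) ⟩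
      2 ^ ∣ B ∣ * suc n                           ∎
      where open ≤-Reasoning

2^b*[1+n]≤2^k*n : ∀ {b k n} → b < k → 1 ≤ n → 2 ^ b * suc n ≤ 2 ^ k * n
2^b*[1+n]≤2^k*n {b} {k} {n} b<k 1≤n = begin
  2 ^ b * suc n       ≡⟨ cong (2 ^ b *_) (+-comm 1 n) ⟩
  2 ^ b * (n + 1)     ≤⟨ *-monoʳ-≤ (2 ^ b) (+-monoʳ-≤ n (≤-trans 1≤n (m≤m+n n 0))) ⟩
  2 ^ b * (2 * n)     ≡⟨ *-assoc (2 ^ b) 2 n ⟨
  2 ^ b * 2 * n       ≡⟨ cong (_* n) (*-comm (2 ^ b) 2) ⟩
  2 ^ suc b * n       ≤⟨ *-monoˡ-≤ n (^-monoʳ-≤ 2 b<k) ⟩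
  2 ^ k * n           ∎
  where open ≤-Reasoning

lemma3p3 : (n r k : ℕ) → r ≤ n → 2 ≤ r → r < k → (L : ℕ → Set) → ListBounded k r L → ThreeGood k r L → (A : Subset n) → ∣ A ∣ ≡ r ∸ 1 → (H : Graph n) → InF n r k L H → DCardLe n r k L A H (2 ^ k * n)
lemma3p3 n r k r≤n 2≤r r<k L _ 3-good A ∣A∣≡r∸1 H _ Gs distinct members = begin
  length Gs          ≤⟨ ∣D∣≤2^∣B∣*[1+n] r≡1+∣A∣ 3-good (p⊆enlarge d A) B-size Gs distinct members ⟩
  2 ^ ∣ B ∣ * suc n  ≤⟨ 2^b*[1+n]≤2^k*n ∣B∣<k (≤-trans (≤-trans (s≤s z≤n) 2≤r) r≤n) ⟩
  2 ^ k * n          ∎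
  where
  open ≤-Reasoning
  d : ℕ
  d = k ∸ suc r
  B : Subset n
  B = enlarge d A
  r≡1+∣A∣ : r ≡ suc ∣ A ∣
  r≡1+∣A∣ = trans (sym (m∸n+n≡m (≤-trans (s≤s z≤n) 2≤r))) (trans (+-comm (r ∸ 1) 1) (cong suc (sym ∣A∣≡r∸1)))
  d+r≡k : d + suc r ≡ k
  d+r≡k = m∸n+n≡m r<k
  B-size : B ≡ ⊤ ⊎ 2 + ∣ B ∣ ≡ k
  B-size = Sum.map₂ (λ ∣B∣≡ → begin-equality
      2 + ∣ B ∣                ≡⟨ cong (2 +_) ∣B∣≡ ⟩
      2 + (d + ∣ A ∣)          ≡⟨ cong suc (+-suc d ∣ A ∣) ⟨
      suc (d + suc ∣ A ∣)      ≡⟨ +-suc d (suc ∣ A ∣) ⟨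
      d + suc (suc ∣ A ∣)      ≡⟨ cong (λ m → d + suc m) r≡1+∣A∣ ⟨
      d + suc r                ≡⟨ d+r≡k ⟩
      k                        ∎) (enlarge≡⊤⊎∣enlarge∣≡ d A)
  ∣B∣<k : ∣ B ∣ < k
  ∣B∣<k = begin-strict
      ∣ B ∣                ≤⟨ ∣enlarge∣≤ d A ⟩
      d + ∣ A ∣            <⟨ +-monoʳ-< d (m≤n⇒m≤1+n (≤-reflexive (sym r≡1+∣A∣))) ⟩
      d + suc r            ≡⟨ d+r≡k ⟩
      k                    ∎
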